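{- Let $\varphi\equiv\Pi:\mathtt{hls}(t'_1,t'_2;t'_3)$ and $\psi\equiv\mathtt{hls}(t_1,t_2;t_3)$ be \textsf{SLAH} formulas with $t_3,t'_3$ terms, and let $\preceq$ be a total preorder over $\{t_1,t_2,t'_1,t'_2\}$ such that $C_\preceq\models t'_1<t'_2\wedge t'_1=t_1\wedge t'_2=t_2$. Let $\xi_{eub,\varphi}(z)$ be a quantifier-free Presburger formula ($z$ fresh) such that for every stack $s$ with $s\models\mathtt{Abs}(\varphi)$ and $s(t'_2)-s(t'_1)\ge2$ and every $n\in\mathbb{N}$, $s[z\gets n]\models\xi_{eub,\varphi}(z)$ iff $n=\mathtt{EUB}_\varphi(s)$. Then $C_\preceq\wedge\Pi:\mathtt{hls}(t'_1,t'_2;t'_3)\models\mathtt{hls}(t_1,t_2;t_3)$ holds if and only if $C_\preceq\wedge\mathtt{Abs}(\varphi)\models\forall z.\,\xi_{eub,\varphi}(z)\rightarrow z\le t_3$.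
   Context: \textsf{SLAH}: terms $t::=x\mid n\mid t+t$ over variables ranging over $\mathbb{N}$; $\Pi$ a conjunction of $\top,\bot,t=t,t\ne t,t\le t,t<t$. Stacks $s:\mathcal{V}\to\mathbb{N}$, heaps $h:\mathbb{N}\rightharpoonup\mathbb{N}$. Semantics: $s,h\models\mathtt{hls}(u_1,u_2;u_3)$ iff $s,h\models\mathtt{hls}^k(u_1,u_2;u_3)$ for some $k$, where $\mathtt{hls}^0$ holds iff $s(u_1)=s(u_2)$ and $\mathrm{dom}(h)=\emptyset$, and $\mathtt{hls}^{\ell+1}(u_1,u_2;u_3)$ holds iff there is $n$ with $2\le n-s(u_1)\le s(u_3)$ and $h=h_1\uplus h_2\uplus h_3$ with $\mathrm{dom}(h_1)=\{s(u_1)\}$, $h_1(s(u_1))=n-s(u_1)$, $\mathrm{dom}(h_2)=\{s(u_1)+1,\dots,n-1\}$, and $h_3$ satisfying $\mathtt{hls}^\ell$ from $n$ to $s(u_2)$ with bound $s(u_3)$. $s,h\models\Pi':\Sigma$ iff $s$ satisfies $\Pi'$ and $s,h\models\Sigma$; $A\models B$ means every model of $A$ is a model of $B$ (for pure formulas, every satisfying stack). $\mathtt{Abs}(\varphi):=\Pi\wedge\big(t'_1=t'_2\vee(t'_1<t'_2\wedge((t'_3=2\wedge t'_1+2\le t'_2\wedge t'_1\equiv_2 t'_2)\vee(2<t'_3\wedge t'_1+2\le t'_2)))\big)$. For a total preorder $\preceq$ on a set of terms, with $\simeq$ its equivalence and $\prec$ its strict part, $C_\preceq:=\bigwedge_{u\simeq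 u'}u=u'\wedge\bigwedge_{u\prec u'}u<u'$. For a stack $s$ with $s\models\mathtt{Abs}(\varphi)$ and $s(t'_2)-s(t'_1)\ge2$, an unfolding scheme is a sequence $(sz_1,\dots,sz_\ell)$ with $2\le sz_i\le s(t'_3)$ and $s(t'_2)=s(t'_1)+\sum_i sz_i$; $\mathtt{EUB}_\varphi(s)$ is the maximum of $\max(sz_1,\dots,sz_\ell)$ over all unfolding schemes. -}

module Defs where

open import Data.Nat using (ℕ; zero; suc; _+_; _∸_; _≤_; _<_; _⊔_; _%_; _≡ᵇ_)
open import Data.Bool using (Bool; true; false; if_then_else_)
open import Data.Maybe using (Maybe; just; nothing)
open import Data.Product using (Σ; ∃; _×_; _,_)
open import Data.Sum using (_⊎_)
open import Data.Unit using (⊤)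
open import Data.Empty using (⊥)
open import Data.List using (List; []; _∷_; foldr)
open import Data.Nat.ListAction using (sum)
open import Data.List.Relation.Unary.All using (All)
open import Data.List.Membership.Propositional using (_∈_)
open import Relation.Nullary using (¬_)
open import Relation.Binary.PropositionalEquality using (_≡_)

Var : Set
Var = ℕ

data Term : Set where
  var  : Var → Term
  num  : ℕ → Term
  _⊕_  : Term → Term → Term

data Atom : Set where
  top bot : Atom
  _=ₐ_ _≠ₐ_ _≤ₐ_ _<ₐ_ : Term → Term → Atom

Pure : Set
Pure = List Atom

Stack : Set
Stack = Var → ℕ

Heap : Set
Heap = ℕ → Maybe ℕ

⟦_⟧ : Term → Stack → ℕ
⟦ var x ⟧ s = s x
⟦ num n ⟧ s = n
⟦ t ⊕ u ⟧ s = ⟦ t ⟧ s + ⟦ u ⟧ s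

_[_↦_] : Stack → Var → ℕ → Stack
(s [ z ↦ n ]) x = if x ≡ᵇ z then n else s x

satAtom : Stack → Atom → Set
satAtom s top = ⊤
satAtom s bot = ⊥
satAtom s (t =ₐ u) = ⟦ t ⟧ s ≡ ⟦ u ⟧ s
satAtom s (t ≠ₐ u) = ¬ (⟦ t ⟧ s ≡ ⟦ u ⟧ s)
satAtom s (t ≤ₐ u) = ⟦ t ⟧ s ≤ ⟦ u ⟧ s
satAtom s (t <ₐ u) = ⟦ t ⟧ s < ⟦ u ⟧ s

satPure : Stack → Pure → Set
satPure s Π = All (satAtom s) Π

OccursT : Var → Term → Set
OccursT z (var x) = x ≡ z
OccursT z (num n) = ⊥
OccursT z (t ⊕ u) = OccursT z t ⊎ OccursT z u

OccursA : Var → Atom → Set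
OccursA z top = ⊥
OccursA z bot = ⊥
OccursA z (t =ₐ u) = OccursT z t ⊎ OccursT z u
OccursA z (t ≠ₐ u) = OccursT z t ⊎ OccursT z u
OccursA z (t ≤ₐ u) = OccursT z t ⊎ OccursT z u
OccursA z (t <ₐ u) = OccursT z t ⊎ OccursT z u

OccursP : Var → Pure → Set
OccursP z [] = ⊥
OccursP z (a ∷ Π) = OccursA z a ⊎ OccursP z Π

InDom : Heap → ℕ → Set
InDom h x = ∃ λ v → h x ≡ just v

EmptyHeap : Heap → Set
EmptyHeap h = ∀ x → h x ≡ nothing

merge : Maybe ℕ → Maybe ℕ → Maybe ℕ
merge (just v) _ = just v
merge nothing m = m

DisjUnion : Heap → Heap → Heap → Set
DisjUnion h h₁ h₂ =
  ∀ x → (h₁ x ≡ nothing ⊎ h₂ x ≡ nothing) × h x ≡ merge (h₁ x) (h₂ x)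

hlsK : ℕ → Heap → ℕ → ℕ → ℕ → Set
hlsK zero h a b c = a ≡ b × EmptyHeap h
hlsK (suc ℓ) h a b c =
  Σ ℕ λ n → (2 ≤ n ∸ a × n ∸ a ≤ c) ×
  Σ Heap λ h₁ → Σ Heap λ h₂ → Σ Heap λ h₃ → Σ Heap λ h₁₂ →
    DisjUnion h h₁₂ h₃ × DisjUnion h₁₂ h₁ h₂ ×
    (∀ x → (InDom h₁ x → x ≡ a) × (x ≡ a → InDom h₁ x)) ×
    h₁ a ≡ just (n ∸ a) ×
    (∀ x → (InDom h₂ x → a < x × x < n) × (a < x × x < n → InDom h₂ x)) ×
    hlsK ℓ h₃ n b c

hls : Stack → Heap → Term → Term → Term → Set
hls s h u₁ u₂ u₃ = ∃ λ k → hlsK k h (⟦ u₁ ⟧ s) (⟦ u₂ ⟧ s) (⟦ u₃ ⟧ s)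

Abs : Pure → Term → Term → Term → Stack → Set
Abs Π t₁ t₂ t₃ s =
  satPure s Π ×
  (⟦ t₁ ⟧ s ≡ ⟦ t₂ ⟧ s ⊎
   (⟦ t₁ ⟧ s < ⟦ t₂ ⟧ s ×
    ((⟦ t₃ ⟧ s ≡ 2 × ⟦ t₁ ⟧ s + 2 ≤ ⟦ t₂ ⟧ s × ⟦ t₁ ⟧ s % 2 ≡ ⟦ t₂ ⟧ s % 2)
     ⊎ (2 < ⟦ t₃ ⟧ s × ⟦ t₁ ⟧ s + 2 ≤ ⟦ t₂ ⟧ s))))

IsTotalPreorderOn : List Term → (Term → Term → Set) → Set
IsTotalPreorderOn D R =
  (∀ {u} → u ∈ D → R u u) ×
  (∀ {u v w} → u ∈ D → v ∈ D → w ∈ D → R u v → R v w → R u w) ×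
  (∀ {u v} → u ∈ D → v ∈ D → R u v ⊎ R v u)

satC : List Term → (Term → Term → Set) → Stack → Set
satC D R s = ∀ {u v} → u ∈ D → v ∈ D →
  ((R u v × R v u) → ⟦ u ⟧ s ≡ ⟦ v ⟧ s) ×
  ((R u v × ¬ R v u) → ⟦ u ⟧ s < ⟦ v ⟧ s)

maxList : List ℕ → ℕ
maxList = foldr _⊔_ 0

IsUnfoldingScheme : Term → Term → Term → Stack → List ℕ → Set
IsUnfoldingScheme t₁ t₂ t₃ s szs =
  All (λ sz → 2 ≤ sz × sz ≤ ⟦ t₃ ⟧ s) szs × ⟦ t₂ ⟧ s ≡ ⟦ t₁ ⟧ s + sum szs

IsEUB : Term → Term → Term → Stack → ℕ → Set
IsEUB t₁ t₂ t₃ s m =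
  (∃ λ szs → IsUnfoldingScheme t₁ t₂ t₃ s szs × maxList szs ≡ m) ×
  (∀ szs → IsUnfoldingScheme t₁ t₂ t₃ s szs → maxList szs ≤ m)

data PForm : Set where
  ptrue pfalse : PForm
  _≤ₚ_ _=ₚ_ : Term → Term → PForm
  _≡[_]ₚ_   : Term → ℕ → Term → PForm
  ¬ₚ_       : PForm → PForm
  _∧ₚ_ _∨ₚ_ : PForm → PForm → PForm

satPF : Stack → PForm → Set
satPF s ptrue = ⊤
satPF s pfalse = ⊥
satPF s (t ≤ₚ u) = ⟦ t ⟧ s ≤ ⟦ u ⟧ s
satPF s (t =ₚ u) = ⟦ t ⟧ s ≡ ⟦ u ⟧ s
satPF s (t ≡[ zero ]ₚ u) = ⟦ t ⟧ s ≡ ⟦ u ⟧ s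
satPF s (t ≡[ suc k ]ₚ u) = ⟦ t ⟧ s % suc k ≡ ⟦ u ⟧ s % suc k
satPF s (¬ₚ f) = ¬ satPF s f
satPF s (f ∧ₚ g) = satPF s f × satPF s g
satPF s (f ∨ₚ g) = satPF s f ⊎ satPF s g

{-# OPTIONS --safe #-}
module Submission where

open import Defs
open import Data.Empty using (⊥-elim)
open import Data.List using (List; []; _∷_; length)
open import Data.List.Properties using (foldr-preservesᵇ)
open import Data.List.Relation.Unary.All as All using (All; []; _∷_)
open import Data.Maybe using (just; nothing)
open import Data.Maybe.Properties using (just-injective)
open import Data.Nat using (ℕ; suc; _+_; _*_; _∸_; _%_; _≤_; _<_; _≟_; _<?_; z≤n; s≤s)
open import Data.Nat.DivMod using ([m+kn]%n≡m%n)
open import Data.Nat.ListAction using (sum)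
open import Data.Nat.Properties
open import Data.Product using (∃; _×_; _,_; proj₁; proj₂; map₂)
open import Data.Sum using (_⊎_; inj₁; inj₂)
open import Function.Bundles using (_⇔_; mk⇔; Equivalence)
open import Relation.Binary using (tri<; tri≈; tri>)
open import Relation.Nullary using (¬_; Dec; yes; no)
open import Relation.Binary.PropositionalEquality
  using (_≡_; _≢_; refl; sym; trans; cong; cong₂; subst; subst₂; module ≡-Reasoning)

-- An hls segment from a to b with bound c is a sequence of blocks, each a header cell holding
-- the block size followed by the body.  Its heap therefore determines an unfolding scheme of
-- b − a with all sizes at most c, and every scheme is realised by a heap.  So the entailment
-- holds iff no scheme for the bound t'₃ uses a block larger than t₃, i.e. iff EUB ≤ t₃.
-- Forwards, we realise a scheme whose first block has size EUB; the entailment then bounds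
-- that header by t₃.  Backwards, the EUB has to exist, and we compute it: for c ≥ 3 and a
-- distance d ≥ 2 it is d if d ≤ c, c − 1 if d = c + 1 (a block of size c would leave 1), and c
-- otherwise (the rest is filled with blocks of sizes 2 and 3); for c = 2 it is 2.  Abs(φ)
-- holds on every model because blocks have size at least 2, and all have size exactly 2 when
-- t'₃ = 2, whence the parity condition.

Blocks : ℕ → List ℕ → Set
Blocks c = All (λ sz → 2 ≤ sz × sz ≤ c)

Partition : ℕ → ℕ → List ℕ → Set
Partition c d szs = Blocks c szs × sum szs ≡ d

Scheme : ℕ → ℕ → ℕ → List ℕ → Set
Scheme a b c szs = Blocks c szs × b ≡ a + sum szs

IsEUBℕ : ℕ → ℕ → ℕ → ℕ → Set
IsEUBℕ a b c m =
  (∃ λ szs → Scheme a b c szs × maxList szs ≡ m) × (∀ szs → Scheme a b c szs → maxList szs ≤ m)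

Hls : Heap → ℕ → ℕ → ℕ → Set
Hls h a b c = ∃ λ k → hlsK k h a b c

AbsShape : ℕ → ℕ → ℕ → Set
AbsShape a b c = (c ≡ 2 × a + 2 ≤ b × a % 2 ≡ b % 2) ⊎ (2 < c × a + 2 ≤ b)

LargestBlock : ℕ → ℕ → ℕ → Set
LargestBlock c d m =
  (∃ λ rest → Partition c d (m ∷ rest)) × (∀ {szs} → Partition c d szs → All (_≤ m) szs)

maxList-lub : ∀ {n xs} → All (_≤ n) xs → maxList xs ≤ n
maxList-lub = foldr-preservesᵇ ⊔-lub z≤n

2≤m∸n⇒n≤m : ∀ {m n} → 2 ≤ m ∸ n → n ≤ m
2≤m∸n⇒n≤m 2≤m∸n = <⇒≤ (m∸n≢0⇒n<m (λ m∸n≡0 → n≮0 (subst (2 ≤_) m∸n≡0 2≤m∸n)))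

sum≡0⊎2≤sum : ∀ {xs} → All (2 ≤_) xs → sum xs ≡ 0 ⊎ 2 ≤ sum xs
sum≡0⊎2≤sum [] = inj₁ refl
sum≡0⊎2≤sum {x ∷ xs} (2≤x ∷ _) = inj₂ (≤-trans 2≤x (m≤m+n x (sum xs)))

all-≡sum⊎+2≤sum : ∀ {xs} → All (2 ≤_) xs → All (λ x → x ≡ sum xs ⊎ x + 2 ≤ sum xs) xs
all-≡sum⊎+2≤sum [] = []
all-≡sum⊎+2≤sum {x ∷ xs} (2≤x ∷ 2≤xs) =
  first (sum≡0⊎2≤sum 2≤xs) ∷ All.map later (all-≡sum⊎+2≤sum 2≤xs)
  where
  first : sum xs ≡ 0 ⊎ 2 ≤ sum xs → x ≡ x + sum xs ⊎ x + 2 ≤ x + sum xs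
  first (inj₁ Σ≡0) = inj₁ (sym (trans (cong (x +_) Σ≡0) (+-identityʳ x)))
  first (inj₂ 2≤Σ) = inj₂ (+-monoʳ-≤ x 2≤Σ)
  later : ∀ {y} → y ≡ sum xs ⊎ y + 2 ≤ sum xs → y ≡ x + sum xs ⊎ y + 2 ≤ x + sum xs
  later (inj₁ refl) = inj₂ (subst (sum xs + 2 ≤_) (+-comm (sum xs) x) (+-monoʳ-≤ (sum xs) 2≤x))
  later (inj₂ y+2≤Σ) = inj₂ (≤-trans y+2≤Σ (m≤n+m (sum xs) x))

sum≡length*2 : ∀ {c xs} → Blocks c xs → c ≤ 2 → sum xs ≡ length xs * 2
sum≡length*2 [] _ = refl
sum≡length*2 ((2≤x , x≤c) ∷ bs) c≤2 =
  cong₂ _+_ (≤-antisym (≤-trans x≤c c≤2) 2≤x) (sum≡length*2 bs c≤2)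

partition-≤bound : ∀ {c d szs} → Partition c d szs → All (_≤ c) szs
partition-≤bound (bs , _) = All.map proj₂ bs

partition-gaps : ∀ {c d szs} → Partition c d szs → All (λ q → q ≡ d ⊎ q + 2 ≤ d) szs
partition-gaps (bs , refl) = all-≡sum⊎+2≤sum (All.map proj₁ bs)

twosAndThrees : ∀ r → ∃ (Partition 3 (2 + r))
twosAndThrees 0 = 2 ∷ [] , (≤-refl , n≤1+n 2) ∷ [] , refl
twosAndThrees 1 = 3 ∷ [] , (n≤1+n 2 , ≤-refl) ∷ [] , refl
twosAndThrees (suc (suc r)) with twosAndThrees r
... | S , bs , Σ≡2+r = 2 ∷ S , (≤-refl , n≤1+n 2) ∷ bs , cong (2 +_) Σ≡2+r

largestBlock-short : ∀ {c d} → 2 ≤ d → d ≤ c → LargestBlock c d d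
largestBlock-short {d = d} 2≤d d≤c =
  ([] , (2≤d , d≤c) ∷ [] , +-identityʳ d) , λ p → All.map below (partition-gaps p)
  where
  below : ∀ {q} → q ≡ d ⊎ q + 2 ≤ d → q ≤ d
  below (inj₁ refl) = ≤-refl
  below {q} (inj₂ q+2≤d) = m+n≤o⇒m≤o q q+2≤d

largestBlock-one-over : ∀ {m} → 2 ≤ m → LargestBlock (suc m) (2 + m) m
largestBlock-one-over {m} 2≤m =
  (2 ∷ [] , (2≤m , n≤1+n m) ∷ (≤-refl , m≤n⇒m≤1+n 2≤m) ∷ [] , +-comm m 2) ,
  λ p → All.zipWith below (partition-≤bound p , partition-gaps p)
  where
  below : ∀ {q} → q ≤ suc m × (q ≡ 2 + m ⊎ q + 2 ≤ 2 + m) → q ≤ m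
  below (2+m≤1+m , inj₁ refl) = ⊥-elim (n≮n (suc m) 2+m≤1+m)
  below {q} (_ , inj₂ q+2≤2+m) = +-cancelʳ-≤ 2 q m (subst (q + 2 ≤_) (+-comm 2 m) q+2≤2+m)

largestBlock-long : ∀ {c} → 3 ≤ c → ∀ r → LargestBlock c (2 + c + r) c
largestBlock-long {c} 3≤c r with twosAndThrees r
... | S , bs , Σ≡2+r =
  (S , (<⇒≤ 3≤c , ≤-refl) ∷ All.map (map₂ (λ sz≤3 → ≤-trans sz≤3 3≤c)) bs , c+Σ≡2+c+r) ,
  partition-≤bound
  where
  open ≡-Reasoning
  c+Σ≡2+c+r : c + sum S ≡ 2 + c + r
  c+Σ≡2+c+r = begin
    c + sum S    ≡⟨ cong (c +_) Σ≡2+r ⟩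
    c + (2 + r)  ≡⟨ +-assoc c 2 r ⟨
    c + 2 + r    ≡⟨ cong (_+ r) (+-comm c 2) ⟩
    2 + c + r    ∎

largestBlock-≥3 : ∀ {c d} → 3 ≤ c → 2 ≤ d → ∃ (LargestBlock c d)
largestBlock-≥3 {suc m} {d} 3≤1+m 2≤d with <-cmp d (2 + m)
... | tri< d<2+m _ _ = d , largestBlock-short 2≤d (m<1+n⇒m≤n d<2+m)
... | tri≈ _ refl _ = m , largestBlock-one-over (m<1+n⇒m≤n 3≤1+m)
... | tri> _ _ 3+m≤d with m≤n⇒∃[o]m+o≡n 3+m≤d
...   | r , refl = suc m , largestBlock-long 3≤1+m r

largestBlock : ∀ {c x xs} → Blocks c (x ∷ xs) → ∃ (LargestBlock c (sum (x ∷ xs)))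
largestBlock {c} {x} {xs} bs@((2≤x , x≤c) ∷ _) with 2 <? c
... | yes 2<c = largestBlock-≥3 2<c (≤-trans 2≤x (m≤m+n x (sum xs)))
... | no 2≮c = c , (xs , subst (λ y → Partition c (x + sum xs) (y ∷ xs)) x≡c (bs , refl)) ,
                   partition-≤bound
  where
  x≡c : x ≡ c
  x≡c = ≤-antisym x≤c (≤-trans (≮⇒≥ 2≮c) 2≤x)

<⇒¬Scheme[] : ∀ {a b c} → a < b → ¬ Scheme a b c []
<⇒¬Scheme[] {a} a<b (_ , b≡a+0) = <-irrefl (sym (trans b≡a+0 (+-identityʳ a))) a<b

scheme-largestBlock : ∀ {a b c szs} → a < b → Scheme a b c szs → ∃ (LargestBlock c (sum szs))
scheme-largestBlock {szs = []} a<b s = ⊥-elim (<⇒¬Scheme[] a<b s)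
scheme-largestBlock {szs = _ ∷ _} _ (bs , _) = largestBlock bs

scheme⇒partition : ∀ {a b c d szs} → b ≡ a + d → Scheme a b c szs → Partition c d szs
scheme⇒partition {a} b≡a+d (bs , b≡a+Σ) = bs , +-cancelˡ-≡ a _ _ (trans (sym b≡a+Σ) b≡a+d)

largestBlock⇒IsEUB : ∀ {a b c d m} → b ≡ a + d → LargestBlock c d m → IsEUBℕ a b c m
largestBlock⇒IsEUB b≡a+d ((rest , bs , refl) , bounded) =
  (_ ∷ rest , (bs , b≡a+d) , m≥n⇒m⊔n≡m (maxList-lub (All.tail (bounded (bs , refl))))) ,
  λ szs s → maxList-lub (bounded (scheme⇒partition b≡a+d s))

scheme⇒absShape : ∀ {a b c szs} → a < b → Scheme a b c szs → AbsShape a b c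
scheme⇒absShape {szs = []} a<b s = ⊥-elim (<⇒¬Scheme[] a<b s)
scheme⇒absShape {a} {c = c} {x ∷ xs} _ (bs@((2≤x , x≤c) ∷ _) , refl) = shape (2 <? c)
  where
  a+2≤b : a + 2 ≤ a + sum (x ∷ xs)
  a+2≤b = +-monoʳ-≤ a (≤-trans 2≤x (m≤m+n x (sum xs)))
  shape : Dec (2 < c) → AbsShape a (a + sum (x ∷ xs)) c
  shape (yes 2<c) = inj₂ (2<c , a+2≤b)
  shape (no 2≮c) = inj₁ (≤-antisym c≤2 (≤-trans 2≤x x≤c) , a+2≤b , sym parity)
    where
    open ≡-Reasoning
    c≤2 : c ≤ 2
    c≤2 = ≮⇒≥ 2≮c
    parity : (a + sum (x ∷ xs)) % 2 ≡ a % 2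
    parity = begin
      (a + sum (x ∷ xs)) % 2             ≡⟨ cong (λ Σ → (a + Σ) % 2) (sum≡length*2 bs c≤2) ⟩
      (a + length (x ∷ xs) * 2) % 2      ≡⟨ [m+kn]%n≡m%n a (length (x ∷ xs)) 2 ⟩
      a % 2                              ∎

abs-gap : ∀ {a b c} → a ≡ b ⊎ (a < b × AbsShape a b c) → a < b → 2 ≤ b ∸ a
abs-gap (inj₁ a≡b) a<b = ⊥-elim (<⇒≢ a<b a≡b)
abs-gap {a} {b} {c} (inj₂ (_ , shape)) _ = m+n≤o⇒m≤o∸n 2 (subst (_≤ b) (+-comm a 2) (a+2≤b shape))
  where
  a+2≤b : AbsShape a b c → a + 2 ≤ b
  a+2≤b (inj₁ (_ , le , _)) = le
  a+2≤b (inj₂ (_ , le))     = le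

singleton : ℕ → ℕ → Heap
singleton a v x with x ≟ a
... | yes _ = just v
... | no _  = nothing

interval : ℕ → ℕ → Heap
interval a n x with a <? x | x <? n
... | yes _ | yes _ = just 0
... | _     | _     = nothing

block : ℕ → ℕ → Heap
block a sz x = merge (singleton a sz x) (interval a (a + sz) x)

layout : ℕ → List ℕ → Heap
layout a []         x = nothing
layout a (sz ∷ szs) x = merge (block a sz x) (layout (a + sz) szs x)

singleton-at : ∀ a v → singleton a v a ≡ just v
singleton-at a v with a ≟ a
... | yes _  = refl
... | no a≢a = ⊥-elim (a≢a refl)

singleton-≢ : ∀ {a v x} → x ≢ a → singleton a v x ≡ nothing
singleton-≢ {a} {x = x} x≢a with x ≟ a
... | yes x≡a = ⊥-elim (x≢a x≡a)
... | no _    = refl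

singleton-dom : ∀ a v x → (InDom (singleton a v) x → x ≡ a) × (x ≡ a → InDom (singleton a v) x)
singleton-dom a v x with x ≟ a
... | yes x≡a = (λ _ → x≡a) , (λ _ → v , refl)
... | no x≢a  = (λ { (_ , ()) }) , (λ x≡a → ⊥-elim (x≢a x≡a))

interval-≤ : ∀ {a n x} → x ≤ a → interval a n x ≡ nothing
interval-≤ {a} {x = x} x≤a with a <? x
... | yes a<x = ⊥-elim (<⇒≱ a<x x≤a)
... | no _    = refl

interval-≥ : ∀ {a n x} → n ≤ x → interval a n x ≡ nothing
interval-≥ {a} {n} {x} n≤x with a <? x | x <? n
... | yes _ | yes x<n = ⊥-elim (<⇒≱ x<n n≤x)
... | yes _ | no _    = refl
... | no _  | _       = refl

interval-dom : ∀ a n x →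
  (InDom (interval a n) x → a < x × x < n) × (a < x × x < n → InDom (interval a n) x)
interval-dom a n x with a <? x | x <? n
... | yes a<x | yes x<n = (λ _ → a<x , x<n) , (λ _ → 0 , refl)
... | yes _   | no x≮n  = (λ { (_ , ()) }) , (λ (_ , x<n) → ⊥-elim (x≮n x<n))
... | no a≮x  | _       = (λ { (_ , ()) }) , (λ (a<x , _) → ⊥-elim (a≮x a<x))

block-split : ∀ a sz → DisjUnion (block a sz) (singleton a sz) (interval a (a + sz))
block-split a sz x = disjoint (x ≟ a) , refl
  where
  disjoint : Dec (x ≡ a) → singleton a sz x ≡ nothing ⊎ interval a (a + sz) x ≡ nothing
  disjoint (yes refl) = inj₂ (interval-≤ ≤-refl)
  disjoint (no x≢a)   = inj₁ (singleton-≢ x≢a)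

block-beyond : ∀ {a sz x} → 0 < sz → a + sz ≤ x → block a sz x ≡ nothing
block-beyond {a} {x = x} 0<sz a+sz≤x =
  cong₂ merge (singleton-≢ (λ x≡a → <⇒≢ a<x (sym x≡a))) (interval-≥ a+sz≤x)
  where
  a<x : a < x
  a<x = <-≤-trans (m<m+n a 0<sz) a+sz≤x

layout-below : ∀ {a x} szs → x < a → layout a szs x ≡ nothing
layout-below [] _ = refl
layout-below {a} (sz ∷ szs) x<a =
  cong₂ merge (cong₂ merge (singleton-≢ (<⇒≢ x<a)) (interval-≤ (<⇒≤ x<a)))
              (layout-below szs (<-≤-trans x<a (m≤m+n a sz)))

layout-split : ∀ a sz szs → 0 < sz →
  DisjUnion (layout a (sz ∷ szs)) (block a sz) (layout (a + sz) szs)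
layout-split a sz szs 0<sz x = disjoint (x <? a + sz) , refl
  where
  disjoint : Dec (x < a + sz) → block a sz x ≡ nothing ⊎ layout (a + sz) szs x ≡ nothing
  disjoint (yes x<a+sz) = inj₂ (layout-below szs x<a+sz)
  disjoint (no x≮a+sz)  = inj₁ (block-beyond 0<sz (≮⇒≥ x≮a+sz))

layout-head : ∀ a sz szs → layout a (sz ∷ szs) a ≡ just sz
layout-head a sz szs rewrite singleton-at a sz = refl

layout-hls : ∀ a {c szs} → Blocks c szs → hlsK (length szs) (layout a szs) a (a + sum szs) c
layout-hls a [] = sym (+-identityʳ a) , λ _ → refl
layout-hls a {c} {sz ∷ szs} ((2≤sz , sz≤c) ∷ bs) =
  a + sz , subst (λ k → 2 ≤ k × k ≤ c) (sym a+sz∸a≡sz) (2≤sz , sz≤c) ,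
  singleton a sz , interval a (a + sz) , layout (a + sz) szs , block a sz ,
  layout-split a sz szs (≤-trans (s≤s z≤n) 2≤sz) , block-split a sz ,
  singleton-dom a sz , trans (singleton-at a sz) (cong just (sym a+sz∸a≡sz)) ,
  interval-dom a (a + sz) ,
  subst (λ b → hlsK (length szs) (layout (a + sz) szs) (a + sz) b c)
        (+-assoc a sz (sum szs)) (layout-hls (a + sz) bs)
  where
  a+sz∸a≡sz : a + sz ∸ a ≡ sz
  a+sz∸a≡sz = m+n∸m≡n a sz

disjUnion-just : ∀ {h h₁ h₂ x v} → DisjUnion h h₁ h₂ → h₁ x ≡ just v → h x ≡ just v
disjUnion-just {h₂ = h₂} {x} h≡h₁⊎h₂ h₁x≡v =
  trans (proj₂ (h≡h₁⊎h₂ x)) (cong (λ m → merge m (h₂ x)) h₁x≡v)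

hlsK-head≤ : ∀ {k h a b c sz} → a < b → hlsK k h a b c → h a ≡ just sz → sz ≤ c
hlsK-head≤ {0} a<b (a≡b , _) _ = ⊥-elim (<⇒≢ a<b a≡b)
hlsK-head≤ {suc _} {c = c} _
  (_ , (_ , n∸a≤c) , _ , _ , _ , _ , h≡h₁₂⊎h₃ , h₁₂≡h₁⊎h₂ , _ , h₁a , _ , _) ha =
  subst (_≤ c)
        (just-injective (trans (sym (disjUnion-just h≡h₁₂⊎h₃ (disjUnion-just h₁₂≡h₁⊎h₂ h₁a))) ha))
        n∸a≤c

blocks : ∀ {k h a b c} → hlsK k h a b c → List ℕ
blocks {0} _ = []
blocks {suc _} {a = a} (n , _ , _ , _ , _ , _ , _ , _ , _ , _ , _ , rest) = n ∸ a ∷ blocks rest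

blocks-scheme : ∀ {k h a b c} (p : hlsK k h a b c) → Scheme a b c (blocks p)
blocks-scheme {0} {a = a} (a≡b , _) = [] , trans (sym a≡b) (sym (+-identityʳ a))
blocks-scheme {suc _} {a = a} {b} (n , sizes , _ , _ , _ , _ , _ , _ , _ , _ , _ , rest) =
  sizes ∷ proj₁ (blocks-scheme rest) , b≡a+Σ
  where
  open ≡-Reasoning
  a≤n : a ≤ n
  a≤n = 2≤m∸n⇒n≤m (proj₁ sizes)
  b≡a+Σ : b ≡ a + (n ∸ a + sum (blocks rest))
  b≡a+Σ = begin
    b                                ≡⟨ proj₂ (blocks-scheme rest) ⟩
    n + sum (blocks rest)            ≡⟨ cong (_+ sum (blocks rest)) (m+[n∸m]≡n a≤n) ⟨
    a + (n ∸ a) + sum (blocks rest)  ≡⟨ +-assoc a (n ∸ a) _ ⟩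
    a + (n ∸ a + sum (blocks rest))  ∎

hlsK-rebound : ∀ {k h a b c c′} (p : hlsK k h a b c) → All (_≤ c′) (blocks p) → hlsK k h a b c′
hlsK-rebound {0} p _ = p
hlsK-rebound {suc _}
  (n , (2≤n∸a , _) , h₁ , h₂ , h₃ , h₁₂ , s₁ , s₂ , d₁ , h₁a , d₂ , rest) (n∸a≤c′ ∷ rest≤c′) =
  n , (2≤n∸a , n∸a≤c′) , h₁ , h₂ , h₃ , h₁₂ , s₁ , s₂ , d₁ , h₁a , d₂ , hlsK-rebound rest rest≤c′

entailment⇒eub≤ : ∀ {a b c′ c n} → a < b →
  (∀ h → Hls h a b c′ → Hls h a b c) → IsEUBℕ a b c′ n → n ≤ c
entailment⇒eub≤ {a} {b} {c′} {c} {n} a<b entails ((w , w-scheme , maxw≡n) , _)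
  with scheme-largestBlock a<b w-scheme
... | m , (rest , bs , Σ≡Σw) , bounded = begin
  n           ≡⟨ maxw≡n ⟨
  maxList w   ≤⟨ maxList-lub (bounded (proj₁ w-scheme , refl)) ⟩
  m           ≤⟨ hlsK-head≤ a<b (proj₂ realised) (layout-head a m rest) ⟩
  c           ∎
  where
  open ≤-Reasoning
  b≡a+Σ : b ≡ a + sum (m ∷ rest)
  b≡a+Σ = trans (proj₂ w-scheme) (cong (a +_) (sym Σ≡Σw))
  realised : Hls (layout a (m ∷ rest)) a b c
  realised = entails _ (length (m ∷ rest) ,
    subst (λ b → hlsK (length (m ∷ rest)) (layout a (m ∷ rest)) a b c′) (sym b≡a+Σ) (layout-hls a bs))

eub≤⇒entailment : ∀ {h a b c′ c} → a < b →
  (∀ m → IsEUBℕ a b c′ m → m ≤ c) → Hls h a b c′ → Hls h a b c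
eub≤⇒entailment {c = c} a<b eub≤c (k , p) with scheme-largestBlock a<b (blocks-scheme p)
... | m , largest@(_ , bounded) =
  k , hlsK-rebound p (All.map (λ sz≤m → ≤-trans sz≤m m≤c) (bounded (proj₁ (blocks-scheme p) , refl)))
  where
  m≤c : m ≤ c
  m≤c = eub≤c m (largestBlock⇒IsEUB (proj₂ (blocks-scheme p)) largest)

hls⇒absShape : ∀ {h a b c} → a < b → Hls h a b c → AbsShape a b c
hls⇒absShape a<b (_ , p) = scheme⇒absShape a<b (blocks-scheme p)

lemma4 : (Π : Pure) (t₁ t₂ t₃ t₁' t₂' t₃' : Term)
    (R : Term → Term → Set) →
    IsTotalPreorderOn (t₁ ∷ t₂ ∷ t₁' ∷ t₂' ∷ []) R →
    (∀ s → satC (t₁ ∷ t₂ ∷ t₁' ∷ t₂' ∷ []) R s →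
      ⟦ t₁' ⟧ s < ⟦ t₂' ⟧ s × ⟦ t₁' ⟧ s ≡ ⟦ t₁ ⟧ s × ⟦ t₂' ⟧ s ≡ ⟦ t₂ ⟧ s) →
    (z : Var) (ξ : PForm) →
    ¬ OccursP z Π → ¬ OccursT z t₁ → ¬ OccursT z t₂ → ¬ OccursT z t₃ →
    ¬ OccursT z t₁' → ¬ OccursT z t₂' → ¬ OccursT z t₃' →
    (∀ s → Abs Π t₁' t₂' t₃' s → 2 ≤ ⟦ t₂' ⟧ s ∸ ⟦ t₁' ⟧ s → ∀ (n : ℕ) →
      (satPF (s [ z ↦ n ]) ξ ⇔ IsEUB t₁' t₂' t₃' s n)) →
    ((∀ s h → satC (t₁ ∷ t₂ ∷ t₁' ∷ t₂' ∷ []) R s → satPure s Π →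
        hls s h t₁' t₂' t₃' → hls s h t₁ t₂ t₃)
     ⇔
     (∀ s → satC (t₁ ∷ t₂ ∷ t₁' ∷ t₂' ∷ []) R s → Abs Π t₁' t₂' t₃' s →
        ∀ (n : ℕ) → satPF (s [ z ↦ n ]) ξ → n ≤ ⟦ t₃ ⟧ s))
lemma4 Π t₁ t₂ t₃ t₁' t₂' t₃' R _ C⇒ordered z ξ _ _ _ _ _ _ _ ξ⇔EUB = mk⇔
  (λ entails s (C : satC D R s) abs n ξn →
    let a<b , a≡ , b≡ = C⇒ordered s C
        eub = Equivalence.to (ξ⇔EUB s abs (abs-gap (proj₂ abs) a<b) n) ξn
    in entailment⇒eub≤ a<b
         (λ h hls′ → subst₂ (λ a b → Hls h a b _) (sym a≡) (sym b≡) (entails s h C (proj₁ abs) hls′))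
         eub)
  (λ eub≤ s h (C : satC D R s) πs hls′ →
    let a<b , a≡ , b≡ = C⇒ordered s C
        abs = πs , inj₂ (a<b , hls⇒absShape a<b hls′)
        ξ⇐eub m = Equivalence.from (ξ⇔EUB s abs (abs-gap (proj₂ abs) a<b) m)
    in subst₂ (λ a b → Hls h a b _) a≡ b≡
         (eub≤⇒entailment a<b (λ m eub → eub≤ s C abs m (ξ⇐eub m eub)) hls′))
  where
  D : List Term
  D = t₁ ∷ t₂ ∷ t₁' ∷ t₂' ∷ []
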